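{- There exist a finite simple digraph $D$ and a set $S\subseteq V(D)$ such that $S$ is a mutual-visibility set of $D$ but $S$ is not a mutual-visibility set of the underlying undirected graph $G$ of $D$.
   Context: A digraph $D=(V,A)$ has a finite vertex set $V$ and a set $A$ of ordered pairs $(u,v)$ of distinct vertices (arcs); no parallel arcs. A directed path from $u$ to $v$ is a sequence of distinct vertices $u=x_0,\dots,x_k=v$ with $(x_i,x_{i+1})\in A$; its length is $k$ and its internal vertices are $x_1,\dots,x_{k-1}$. A shortest directed $u,v$-path is a directed $u$-to-$v$ path of minimum length. A set $S\subseteq V(D)$ is a mutual-visibility set of $D$ if for all distinct $x,y\in S$ there exist a shortest directed $x,y$-path $P$ and a shortest directed $y,x$-path $Q$ such that $(S\cap V(P))\cup(S\cap V(Q))=\{x,y\}$ (i.e. no internal vertex of $P$ or $Q$ lies in $S$). The underlying undirected graph $G$ of $D$ is obtained by forgetting arc orientations (merging $(u,v)$ and $(v,u)$ into a single edge). In an undirected graph $G$, $S\subseteq V(G)$ is a mutual-visibility set if for all distinct $x,y\in S$ there exists a shortest $x,y$-path in $G$ with no internal vertex in $S$. -}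

module Defs where

open import Data.Nat using (ℕ; zero; suc; _≤_)
open import Data.Fin using (Fin; zero; suc; fromℕ; inject₁)
open import Data.Fin.Subset using (Subset; _∈_)
open import Data.Bool using (Bool; true; false; T; _∨_)
open import Data.Product using (Σ; ∃; ∃-syntax; _×_; _,_)
open import Data.Sum using (_⊎_)
open import Relation.Binary.PropositionalEquality using (_≡_; _≢_)
open import Function.Definitions using (Injective)

-- A finite simple digraph on vertex set Fin n: arcs given by a Boolean
-- adjacency relation (so no parallel arcs) with no loops.
record Digraph : Set where
  field
    n      : ℕ
    arc    : Fin n → Fin n → Bool
    noLoop : ∀ x → arc x x ≡ false
open Digraph public

Rel : ℕ → Set₁
Rel m = Fin m → Fin m → Set

IsPath : ∀ {m} → Rel m → Fin m → Fin m → (k : ℕ) → (Fin (suc k) → Fin m) → Set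
IsPath R u v k p =
  (p zero ≡ u) × (p (fromℕ k) ≡ v) × Injective _≡_ _≡_ p
  × (∀ (i : Fin k) → R (p (inject₁ i)) (p (suc i)))

IsShortestPath : ∀ {m} → Rel m → Fin m → Fin m → (k : ℕ) → (Fin (suc k) → Fin m) → Set
IsShortestPath {m} R u v k p =
  IsPath R u v k p × (∀ (j : ℕ) (q : Fin (suc j) → Fin m) → IsPath R u v j q → k ≤ j)

-- The path p meets S only in vertices among {x , y}
-- (for a path from x to y: no internal vertex lies in S).
AvoidsExcept : ∀ {m k} → Subset m → Fin m → Fin m → (Fin (suc k) → Fin m) → Set
AvoidsExcept {k = k} S x y p = ∀ (i : Fin (suc k)) → p i ∈ S → (p i ≡ x) ⊎ (p i ≡ y)

VisibleVia : ∀ {m} → Rel m → Subset m → Fin m → Fin m → Set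
VisibleVia {m} R S x y =
  ∃[ k ] ∃[ p ] (IsShortestPath R x y k p × AvoidsExcept S x y p)

ArcD : (D : Digraph) → Rel (n D)
ArcD D u v = T (arc D u v)

EdgeG : (D : Digraph) → Rel (n D)
EdgeG D u v = T (arc D u v ∨ arc D v u)

IsMutualVisibilityD : (D : Digraph) → Subset (n D) → Set
IsMutualVisibilityD D S =
  ∀ x y → x ∈ S → y ∈ S → x ≢ y →
    VisibleVia (ArcD D) S x y × VisibleVia (ArcD D) S y x

IsMutualVisibilityG : (D : Digraph) → Subset (n D) → Set
IsMutualVisibilityG D S =
  ∀ x y → x ∈ S → y ∈ S → x ≢ y → VisibleVia (EdgeG D) S x y

{-# OPTIONS --safe #-}
module Submission where

-- Take S = {x, y, z} in the digraph with arcs x → z, y → z, z → a → x,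
-- z → b → y, x → c → b → y and y → d → a → x.  Directed distances are
-- asymmetric: z is adjacent from x and y, but reaching x or y from z, or y
-- from x, takes a detour that avoids S.  In the underlying graph, however,
-- x and y are non-adjacent and z is their only common neighbour, so the
-- unique shortest x,y-path passes through z ∈ S.

open import Defs
open import Data.Fin.Subset using (Subset; _∈_)
open import Data.Product using (∃-syntax; _×_; _,_; proj₂)
open import Relation.Nullary using (¬_)

open import Data.Bool using (Bool; true; false; _∨_)
open import Data.Bool.Properties using (T?) renaming (_≟_ to _≟ᵇ_)
open import Data.Fin using (Fin; zero; suc; toℕ; fromℕ; fromℕ<; inject₁; _≟_)
open import Data.Fin.Properties using (all?; any?; toℕ-fromℕ<)
open import Data.Fin.Subset.Properties using (_∈?_; ∉⊥)
open import Data.Nat using (ℕ; zero; suc)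
open import Data.Nat.Properties using (≮⇒≥; ≤-antisym)
open import Data.Sum using (inj₁; inj₂)
open import Data.Vec using (Vec; []; _∷_; lookup; here; there)
open import Function.Definitions using (Injective)
open import Relation.Binary.Definitions using (Decidable)
open import Relation.Binary.PropositionalEquality using (_≡_; _≢_; refl; sym; subst; ≢-sym)
open import Relation.Nullary.Decidable
  using (Dec; True; toWitness; from-yes; map′; ¬?; _×-dec_; _⊎-dec_; _→-dec_)
open import Relation.Nullary.Negation using (contradiction)

private
  variable
    m k l : ℕ
    R : Rel m
    u v x y : Fin m
    p q : Fin (suc k) → Fin m

Walk : Rel m → ℕ → Fin m → Fin m → Set
Walk R zero    u v = u ≡ v
Walk R (suc j) u v = ∃[ w ] R u w × Walk R j w v

walk? : Decidable R → ∀ j → Decidable (Walk R j)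
walk? R? zero    u v = u ≟ v
walk? R? (suc j) u v = any? λ w → R? u w ×-dec walk? R? j w v

path⇒walk : IsPath R u v k p → Walk R k u v
path⇒walk {k = k} {p = p} (refl , refl , _ , step) = steps⇒walk k p step
  where
  steps⇒walk : ∀ {R : Rel m} k (p : Fin (suc k) → Fin m) →
               (∀ i → R (p (inject₁ i)) (p (suc i))) → Walk R k (p zero) (p (fromℕ k))
  steps⇒walk zero    p step = refl
  steps⇒walk (suc k) p step =
    p (suc zero) , step zero , steps⇒walk k (λ i → p (suc i)) (λ i → step (suc i))

-- Ruling out shorter walks rather than shorter paths turns minimality into a finite search.
NoShorterWalk : Rel m → Fin m → Fin m → ℕ → Set
NoShorterWalk R u v k = ∀ (j : Fin k) → ¬ Walk R (toℕ j) u v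

noShorterWalk? : Decidable R → ∀ u v k → Dec (NoShorterWalk R u v k)
noShorterWalk? R? u v k = all? λ j → ¬? (walk? R? (toℕ j) u v)

noShorterWalk⇒shortest : IsPath R u v k p → NoShorterWalk R u v k → IsShortestPath R u v k p
noShorterWalk⇒shortest {R = R} {u} {v} path noShorter = path , λ j q q-path →
  ≮⇒≥ λ j<k → noShorter (fromℕ< j<k)
    (subst (λ i → Walk R i u v) (sym (toℕ-fromℕ< j<k)) (path⇒walk q-path))

shortest-length : IsShortestPath R u v k p → IsPath R u v l q → NoShorterWalk R u v l → k ≡ l
shortest-length {p = p} (p-path , p-minimal) q-path noShorter =
  ≤-antisym (p-minimal _ _ q-path) (proj₂ (noShorterWalk⇒shortest q-path noShorter) _ p p-path)

injective? : (f : Fin k → Fin m) → Dec (Injective _≡_ _≡_ f)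
injective? f = map′ (λ inj {i} {j} → inj i j) (λ inj i j → inj)
  (all? λ i → all? λ j → f i ≟ f j →-dec i ≟ j)

isPath? : Decidable R → ∀ u v k p → Dec (IsPath R u v k p)
isPath? R? u v k p =
  p zero ≟ u ×-dec p (fromℕ k) ≟ v ×-dec injective? p ×-dec
  all? λ i → R? (p (inject₁ i)) (p (suc i))

avoidsExcept? : ∀ (S : Subset m) x y (p : Fin (suc k) → Fin m) → Dec (AvoidsExcept S x y p)
avoidsExcept? S x y p = all? λ i → p i ∈? S →-dec (p i ≟ x ⊎-dec p i ≟ y)

VisibleAlong : Rel m → Subset m → Fin m → Fin m → (k : ℕ) → (Fin (suc k) → Fin m) → Set
VisibleAlong R S x y k p = IsPath R x y k p × NoShorterWalk R x y k × AvoidsExcept S x y p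

visibleAlong? : Decidable R → ∀ S x y k p → Dec (VisibleAlong R S x y k p)
visibleAlong? R? S x y k p =
  isPath? R? x y k p ×-dec noShorterWalk? R? x y k ×-dec avoidsExcept? S x y p

visibleAlong⇒visibleVia : ∀ {S} → VisibleAlong R S x y k p → VisibleVia R S x y
visibleAlong⇒visibleVia (path , noShorter , avoids) =
  _ , _ , noShorterWalk⇒shortest path noShorter , avoids

commonNeighbours⊆S⇒¬visibleVia : ∀ {S} {p₀ : Fin 3 → Fin m} →
  IsPath R x y 2 p₀ → NoShorterWalk R x y 2 → (∀ w → R x w → R w y → w ∈ S) →
  ¬ VisibleVia R S x y
commonNeighbours⊆S⇒¬visibleVia p₀-path noShorter common⊆S
  (k , p , shortest@((refl , refl , p-injective , step) , _) , avoids)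
  with refl ← shortest-length shortest p₀-path noShorter
  with avoids (suc zero) (common⊆S (p (suc zero)) (step zero) (step (suc zero)))
... | inj₁ p₁≡p₀ = contradiction (p-injective p₁≡p₀) λ ()
... | inj₂ p₁≡p₂ = contradiction (p-injective p₁≡p₂) λ ()

arcD? : (D : Digraph) → Decidable (ArcD D)
arcD? D u v = T? (arc D u v)

edgeG? : (D : Digraph) → Decidable (EdgeG D)
edgeG? D u v = T? (arc D u v ∨ arc D v u)

routeVisible : ∀ D S {k} x y (route : Vec (Fin (n D)) (suc k)) →
  {True (visibleAlong? (arcD? D) S x y k (lookup route))} → VisibleVia (ArcD D) S x y
routeVisible D S x y route {ok} = visibleAlong⇒visibleVia (toWitness ok)

pairwise⇒mutualVisibilityD : ∀ D S →
  (∀ x y → x ∈ S → y ∈ S → x ≢ y → VisibleVia (ArcD D) S x y) → IsMutualVisibilityD D S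
pairwise⇒mutualVisibilityD D S visible x y x∈S y∈S x≢y =
  visible x y x∈S y∈S x≢y , visible y x y∈S x∈S (≢-sym x≢y)

pattern vx = zero
pattern vy = suc zero
pattern vz = suc (suc zero)
pattern va = suc (suc (suc zero))
pattern vb = suc (suc (suc (suc zero)))
pattern vc = suc (suc (suc (suc (suc zero))))
pattern vd = suc (suc (suc (suc (suc (suc zero)))))

D₀ : Digraph
D₀ = record { n = 7 ; arc = arcs ; noLoop = from-yes (all? λ w → arcs w w ≟ᵇ false) }
  where
  arcs : Fin 7 → Fin 7 → Bool
  arcs vx vz = true
  arcs vy vz = true
  arcs vz va = true
  arcs va vx = true
  arcs vz vb = true
  arcs vb vy = true
  arcs vx vc = true
  arcs vc vb = true
  arcs vy vd = true
  arcs vd va = true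
  arcs _  _  = false

S₀ : Subset 7
S₀ = true ∷ true ∷ true ∷ false ∷ false ∷ false ∷ false ∷ []

visibleInD₀ : ∀ x y → x ∈ S₀ → y ∈ S₀ → x ≢ y → VisibleVia (ArcD D₀) S₀ x y
visibleInD₀ x y here                 here                 x≢y = contradiction refl x≢y
visibleInD₀ x y (there here)         (there here)         x≢y = contradiction refl x≢y
visibleInD₀ x y (there (there here)) (there (there here)) x≢y = contradiction refl x≢y
visibleInD₀ x y here                 (there here)         _ = routeVisible D₀ S₀ x y (vx ∷ vc ∷ vb ∷ vy ∷ [])
visibleInD₀ x y (there here)         here                 _ = routeVisible D₀ S₀ x y (vy ∷ vd ∷ va ∷ vx ∷ [])
visibleInD₀ x y here                 (there (there here)) _ = routeVisible D₀ S₀ x y (vx ∷ vz ∷ [])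
visibleInD₀ x y (there here)         (there (there here)) _ = routeVisible D₀ S₀ x y (vy ∷ vz ∷ [])
visibleInD₀ x y (there (there here)) here                 _ = routeVisible D₀ S₀ x y (vz ∷ va ∷ vx ∷ [])
visibleInD₀ x y (there (there here)) (there here)         _ = routeVisible D₀ S₀ x y (vz ∷ vb ∷ vy ∷ [])
visibleInD₀ x y (there (there (there x∈∅))) _ _ = contradiction x∈∅ ∉⊥
visibleInD₀ x y _ (there (there (there y∈∅))) _ = contradiction y∈∅ ∉⊥

notMutualVisibleInG₀ : ¬ IsMutualVisibilityG D₀ S₀
notMutualVisibleInG₀ mutuallyVisible =
  commonNeighbours⊆S⇒¬visibleVia
    (from-yes (isPath? (edgeG? D₀) vx vy 2 (lookup (vx ∷ vz ∷ vy ∷ []))))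
    (from-yes (noShorterWalk? (edgeG? D₀) vx vy 2))
    (from-yes (all? λ w → edgeG? D₀ vx w →-dec edgeG? D₀ w vy →-dec w ∈? S₀))
    (mutuallyVisible vx vy here (there here) λ ())

mainTheorem1 : ∃[ D ] ∃[ S ] (IsMutualVisibilityD D S × ¬ IsMutualVisibilityG D S)
mainTheorem1 = D₀ , S₀ , pairwise⇒mutualVisibilityD D₀ S₀ visibleInD₀ , notMutualVisibleInG₀
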